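{- Let $\Sigma=\{A,C,G,T\}$, $\ell\ge1$, and let $\mathcal{C}$ be an $(n,k)$ code, i.e. an injective encoding map $(\Sigma^\ell)^k\to(\Sigma^\ell)^n$, $\mathcal{U}=(\mathbf{u}_1,\ldots,\mathbf{u}_k)\mapsto\mathcal{X}=(\mathbf{x}_1,\ldots,\mathbf{x}_n)$. Indices in $[n]$ are drawn independently and uniformly at random with replacement; for $i\in[k]$, $\tau_i(\mathcal{C})$ is the smallest $r$ such that there is a function $g$ with $\mathbf{u}_i=g((\mathbf{x}_j)_{j\in J_r})$ for all $\mathcal{U}\in(\Sigma^\ell)^k$, where $J_r$ is the set of indices drawn in the first $r$ draws. Let $T^{\mathcal{C}}_{\max}=\max_{1\le i\le k}\mathbb{E}[\tau_i(\mathcal{C})]$. Then $T^{\mathcal{C}}_{\max}\ge\frac{k+1}{2}$. -}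

module Defs where

open import Data.Nat using (ℕ; zero; suc; _*_; _^_; NonZero)
open import Data.Nat.Properties using (m^n≢0)
open import Data.Bool using (Bool; true; false; _∧_; not; if_then_else_)
open import Data.Fin using (Fin)
import Data.Fin.Properties as FinP
open import Data.Vec using (Vec; []; _∷_; lookup; init)
import Data.Vec.Properties as VecP
import Data.Vec.Membership.DecPropositional as VMem
open import Data.List using (List; allFin; map)
open import Data.Nat.ListAction using (sum)
open import Data.Integer using (+_)
open import Data.Rational using (ℚ; _/_; _+_; 0ℚ; _-_; _≤_; Positive)
open import Data.Product using (∃-syntax; _×_)
open import Relation.Binary.PropositionalEquality using (_≡_)
open import Relation.Nullary using (Dec; yes; no; ¬_)
open import Relation.Nullary.Decidable using (⌊_⌋; _→-dec_)
open import Relation.Unary using (Decidable)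

Alphabet : Set
Alphabet = Fin 4

Word : ℕ → Set
Word ℓ = Vec Alphabet ℓ

Message : ℕ → ℕ → Set
Message ℓ k = Vec (Word ℓ) k

-- An (n,k) code: an encoding map (Σ^ℓ)^k → (Σ^ℓ)^n (injectivity is a hypothesis).
Code : ℕ → ℕ → ℕ → Set
Code ℓ n k = Message ℓ k → Vec (Word ℓ) n

open module M {n : ℕ} = VMem (FinP._≟_ {n}) using (_∈_; _∈?_)

-- u_i is a function of (x_j)_{j ∈ J}, where J is the set of indices
-- appearing in the sequence of draws s:  any two messages whose encodings
-- agree on all positions in J have the same i-th strand.
Recoverable : ∀ {ℓ n k r} → Code ℓ n k → Fin k → Vec (Fin n) r → Set
Recoverable {ℓ} {n} {k} C i s =
  ∀ (U V : Message ℓ k) →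
    (∀ (j : Fin n) → j ∈ s → lookup (C U) j ≡ lookup (C V) j) →
    lookup U i ≡ lookup V i

∀Vec? : ∀ {A : Set} →
        (∀ {P : A → Set} → Decidable P → Dec (∀ x → P x)) →
        ∀ m {P : Vec A m → Set} → Decidable P → Dec (∀ v → P v)
∀Vec? all? zero P? with P? []
... | yes p = yes λ { [] → p }
... | no ¬p = no λ f → ¬p (f [])
∀Vec? all? (suc m) {P} P? with all? (λ x → ∀Vec? all? m (λ v → P? (x ∷ v)))
... | yes f = yes λ { (x ∷ v) → f x v }
... | no ¬f = no λ g → ¬f λ x v → g (x ∷ v)

∀Word? : ∀ ℓ {P : Word ℓ → Set} → Decidable P → Dec (∀ w → P w)
∀Word? ℓ = ∀Vec? FinP.all? ℓ

∀Message? : ∀ ℓ k {P : Message ℓ k → Set} → Decidable P → Dec (∀ U → P U)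
∀Message? ℓ k = ∀Vec? (∀Word? ℓ) k

recoverable? : ∀ {ℓ n k r} (C : Code ℓ n k) (i : Fin k) (s : Vec (Fin n) r) →
               Dec (Recoverable C i s)
recoverable? {ℓ} {n} {k} C i s =
  ∀Message? ℓ k λ U → ∀Message? ℓ k λ V →
    FinP.all? (λ j → (j ∈? s) →-dec VecP.≡-dec FinP._≟_ (lookup (C U) j) (lookup (C V) j))
    →-dec VecP.≡-dec FinP._≟_ (lookup U i) (lookup V i)

count : ∀ {n} (r : ℕ) → (Vec (Fin n) r → Bool) → ℕ
count zero    P = if P [] then 1 else 0
count {n} (suc r) P = sum (map (λ j → count r (λ v → P (j ∷ v))) (allFin n))

-- τ_i(s) = r+1 for a draw sequence s = (d_1,…,d_{r+1}): the first r+1 draws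
-- recover u_i and the first r draws do not.
stopsAt : ∀ {ℓ n k r} → Code ℓ n k → Fin k → Vec (Fin n) (suc r) → Bool
stopsAt C i s = ⌊ recoverable? C i s ⌋ ∧ not ⌊ recoverable? C i (init s) ⌋

-- (r+1) · P(τ_i = r+1), draws uniform on [n], independent.
term : ∀ {ℓ n k} .{{_ : NonZero n}} → Code ℓ n k → Fin k → ℕ → ℚ
term {n = n} C i r =
  (+ (suc r * count (suc r) (stopsAt C i))) / (n ^ suc r)
  where instance _ = m^n≢0 n (suc r)

-- Partial sum Σ_{t=1}^{R} t · P(τ_i = t) of the series defining E[τ_i]
-- (the t = 0 term is 0).
partialE : ∀ {ℓ n k} .{{_ : NonZero n}} → Code ℓ n k → Fin k → ℕ → ℚ
partialE C i zero    = 0ℚ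
partialE C i (suc R) = partialE C i R + term C i R

-- T^C_max = max_i E[τ_i] = sup_{i,R} partialE C i R  is ≥ q.
TmaxAtLeast : ∀ {ℓ n k} .{{_ : NonZero n}} → Code ℓ n k → ℚ → Set
TmaxAtLeast {k = k} C q =
  ∀ (ε : ℚ) → Positive ε → ∃[ i ] ∃[ R ] (q - ε ≤ partialE C i R)

-- Let N i r count the draw sequences of length r from which u_i can be recovered.
-- Since C is injective, r observed strands determine at most r of the k message
-- strands, so ∑_i N i r ≤ n^r · min(r, k); a sequence hitting every index determines
-- all of them, so ∑_i N i r ≥ k n^r − k n (n−1)^r.  Summation by parts writes the
-- truncated expectation ∑_{t ≤ R} t · P(τ_i = t) as R · P(τ_i ≤ R) − ∑_{r < R} P(τ_i ≤ r);
-- summed over i, the two bounds make its average at least (k+1)/2 − R n (n−1)^R / n^R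
-- once R ≥ k.  The error term tends to 0, so for large R some i comes within ε of (k+1)/2.

module Submission where

open import Data.Bool using (Bool; true; false; not; _∧_; if_then_else_; T)
open import Data.Empty using (⊥-elim)
open import Data.Fin using (Fin; zero; suc; punchIn)
open import Data.Fin.Properties using (*↔×; injective⇒≤; all?; ¬∀⟶∃¬)
open import Data.Integer as ℤ using (+_; +[1+_]; +≤+)
open import Data.Integer.Properties using (pos-*)
import Data.List as List using (map; tabulate)
open import Data.Nat using (ℕ; zero; suc; _+_; _*_; _∸_; _^_; _⊓_; _≤_; _<_; z≤n; s≤s; NonZero)
open import Data.Nat.Coprimality using (Coprime)
open import Data.Nat.ListAction using () renaming (sum to sumᴸ)
open import Data.Nat.Properties
open import Data.Nat.Tactic.RingSolver using (solve-∀)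
open import Data.Product using (_×_; _,_; proj₁; proj₂; ∃-syntax; uncurry)
open import Data.Product.Function.NonDependent.Propositional using (_×-↔_)
open import Data.Rational as ℚ using (mkℚ; _/_)
open import Data.Rational.Properties using (toℚᵘ-fromℚᵘ; toℚᵘ-homo-+; toℚᵘ-homo‿-; toℚᵘ-cancel-≤)
import Data.Rational.Unnormalised as ℚᵘ
import Data.Rational.Unnormalised.Properties as ℚᵘₚ
open ℚᵘ using (ℚᵘ; _≃_; *≡*; *≤*)
open import Data.Sum using (inj₁; inj₂)
open import Data.Vec using (Vec; []; _∷_; init; uncons; lookup; map; replicate)
open import Data.Vec.Membership.Propositional using (_∈_)
open import Data.Vec.Properties using (∷-injective; tabulate∘lookup; tabulate-cong)
open import Data.Vec.Relation.Unary.Any using (here; there)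
open import Function using (_∘_)
open import Function.Bundles using (_↔_; mk↔ₛ′; Inverse; Injection)
open import Function.Definitions using (Injective)
open import Function.Properties.Inverse using (↔-trans; ↔-sym; ↔-refl; Inverse⇒Injection)
open import Relation.Binary.PropositionalEquality
open import Relation.Nullary using (¬_; contradiction; yes; no)
open import Relation.Nullary.Decidable using (⌊_⌋; toWitness; fromWitness; ¬?)

open import Algebra.Properties.Semiring.Sum +-*-semiring
  using (sum; sum-syntax; sum-cong-≗; ∑-distrib-+; ∑-comm; *-distribˡ-sum; sum-remove)

open import Defs hiding (module M)
open Defs.M using (_∈?_)

sum-mono-≤ : ∀ {m} {f g : Fin m → ℕ} → (∀ i → f i ≤ g i) → sum f ≤ sum g
sum-mono-≤ {zero}  f≤g = z≤n
sum-mono-≤ {suc m} f≤g = +-mono-≤ (f≤g zero) (sum-mono-≤ (f≤g ∘ suc))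

sum-const : ∀ m c → ∑[ i < m ] c ≡ m * c
sum-const zero    c = refl
sum-const (suc m) c = cong (_+_ c) (sum-const m c)

sum-≤-const : ∀ {m} {f : Fin m → ℕ} {c} → (∀ i → f i ≤ c) → sum f ≤ m * c
sum-≤-const {m} {c = c} f≤c = ≤-trans (sum-mono-≤ f≤c) (≤-reflexive (sum-const m c))

sum-≤-punctured : ∀ {m} (f : Fin (suc m) → ℕ) {c} (i : Fin (suc m)) →
                  f i ≡ 0 → (∀ j → f j ≤ c) → sum f ≤ m * c
sum-≤-punctured f i fi≡0 f≤c rewrite sum-remove {i = i} f | fi≡0 = sum-≤-const (f≤c ∘ punchIn i)

∃-sum≤*max : ∀ {m} (f : Fin (suc m) → ℕ) → ∃[ i ] sum f ≤ suc m * f i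
∃-sum≤*max {zero}  f = zero , ≤-refl
∃-sum≤*max {suc m} f with ∃-sum≤*max (f ∘ suc)
... | i , ∑≤ with ≤-total (f zero) (f (suc i))
... | inj₁ f₀≤fᵢ = suc i , +-mono-≤ f₀≤fᵢ ∑≤
... | inj₂ fᵢ≤f₀ = zero , +-monoʳ-≤ (f zero) (≤-trans ∑≤ (*-monoʳ-≤ (suc m) fᵢ≤f₀))

-- Sums over draw sequences

∑seq : ∀ {n} r → (Vec (Fin n) r → ℕ) → ℕ
∑seq zero        f = f []
∑seq {n} (suc r) f = ∑[ j < n ] ∑seq r (f ∘ (j ∷_))

module _ {n : ℕ} where

  ∑seq-cong : ∀ r {f g : Vec (Fin n) r → ℕ} → (∀ s → f s ≡ g s) → ∑seq r f ≡ ∑seq r g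
  ∑seq-cong zero    f≗g = f≗g []
  ∑seq-cong (suc r) f≗g = sum-cong-≗ λ j → ∑seq-cong r (f≗g ∘ (j ∷_))

  ∑seq-mono-≤ : ∀ r {f g : Vec (Fin n) r → ℕ} → (∀ s → f s ≤ g s) → ∑seq r f ≤ ∑seq r g
  ∑seq-mono-≤ zero    f≤g = f≤g []
  ∑seq-mono-≤ (suc r) f≤g = sum-mono-≤ λ j → ∑seq-mono-≤ r (f≤g ∘ (j ∷_))

  ∑seq-distrib-+ : ∀ r (f g : Vec (Fin n) r → ℕ) → ∑seq r (λ s → f s + g s) ≡ ∑seq r f + ∑seq r g
  ∑seq-distrib-+ zero    f g = refl
  ∑seq-distrib-+ (suc r) f g =
    trans (sum-cong-≗ λ j → ∑seq-distrib-+ r (f ∘ (j ∷_)) (g ∘ (j ∷_)))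
          (∑-distrib-+ (λ j → ∑seq r (f ∘ (j ∷_))) (λ j → ∑seq r (g ∘ (j ∷_))))

  *-distribˡ-∑seq : ∀ r c (f : Vec (Fin n) r → ℕ) → c * ∑seq r f ≡ ∑seq r (λ s → c * f s)
  *-distribˡ-∑seq zero    c f = refl
  *-distribˡ-∑seq (suc r) c f =
    trans (*-distribˡ-sum c (λ j → ∑seq r (f ∘ (j ∷_))))
          (sum-cong-≗ λ j → *-distribˡ-∑seq r c (f ∘ (j ∷_)))

  ∑seq-const : ∀ r c → ∑seq {n} r (λ _ → c) ≡ n ^ r * c
  ∑seq-const zero    c = sym (+-identityʳ c)
  ∑seq-const (suc r) c = begin
    ∑[ j < n ] ∑seq {n} r (λ _ → c) ≡⟨ cong (λ x → ∑[ j < n ] x) (∑seq-const r c) ⟩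
    ∑[ j < n ] (n ^ r * c)          ≡⟨ sum-const n (n ^ r * c) ⟩
    n * (n ^ r * c)                 ≡⟨ *-assoc n (n ^ r) c ⟨
    n ^ suc r * c                   ∎
    where open ≡-Reasoning

  ∑seq-comm : ∀ {k} r (f : Fin k → Vec (Fin n) r → ℕ) →
              ∑seq r (λ s → ∑[ i < k ] f i s) ≡ ∑[ i < k ] ∑seq r (f i)
  ∑seq-comm zero    f = refl
  ∑seq-comm (suc r) f =
    trans (sum-cong-≗ λ j → ∑seq-comm r (λ i → f i ∘ (j ∷_)))
          (∑-comm (λ j i → ∑seq r (f i ∘ (j ∷_))))

  ∑seq-init : ∀ r (f : Vec (Fin n) r → ℕ) → ∑seq (suc r) (f ∘ init) ≡ n * ∑seq r f
  ∑seq-init zero    f = sum-const n (f [])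
  ∑seq-init (suc r) f = begin
    ∑[ j < n ] ∑seq (suc r) (f ∘ init ∘ (j ∷_)) ≡⟨ sum-cong-≗ (λ j → ∑seq-init r (f ∘ (j ∷_))) ⟩
    ∑[ j < n ] (n * ∑seq r (f ∘ (j ∷_)))        ≡⟨ *-distribˡ-sum n (λ j → ∑seq r (f ∘ (j ∷_))) ⟨
    n * ∑seq (suc r) f                          ∎
    where open ≡-Reasoning

𝟙 : Bool → ℕ
𝟙 b = if b then 1 else 0

𝟙≤1 : ∀ b → 𝟙 b ≤ 1
𝟙≤1 true  = s≤s z≤n
𝟙≤1 false = z≤n

𝟙-mono : ∀ {a b} → (T a → T b) → 𝟙 a ≤ 𝟙 b
𝟙-mono {false}         a⇒b = z≤n
𝟙-mono {true}  {true}  a⇒b = ≤-refl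
𝟙-mono {true}  {false} a⇒b = ⊥-elim (a⇒b _)

¬T⇒𝟙≡0 : ∀ {b} → ¬ T b → 𝟙 b ≡ 0
¬T⇒𝟙≡0 {false} ¬b = refl
¬T⇒𝟙≡0 {true}  ¬b = contradiction _ ¬b

T⇒𝟙≡1 : ∀ {b} → T b → 𝟙 b ≡ 1
T⇒𝟙≡1 {true} _ = refl

𝟙-∧-not : ∀ a b → (T b → T a) → 𝟙 (a ∧ not b) + 𝟙 b ≡ 𝟙 a
𝟙-∧-not true  true  b⇒a = refl
𝟙-∧-not true  false b⇒a = refl
𝟙-∧-not false true  b⇒a = ⊥-elim (b⇒a _)
𝟙-∧-not false false b⇒a = refl

sum-map-tabulate : ∀ {A : Set} {m} (f : A → ℕ) (g : Fin m → A) →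
                   sumᴸ (List.map f (List.tabulate g)) ≡ ∑[ i < m ] f (g i)
sum-map-tabulate {m = zero}  f g = refl
sum-map-tabulate {m = suc m} f g = cong (_+_ (f (g zero))) (sum-map-tabulate f (g ∘ suc))

count≡∑seq : ∀ {n} r (P : Vec (Fin n) r → Bool) → count r P ≡ ∑seq r (𝟙 ∘ P)
count≡∑seq zero    P = refl
count≡∑seq (suc r) P =
  trans (sum-map-tabulate (λ j → count r (P ∘ (j ∷_))) (λ j → j))
        (sum-cong-≗ λ j → count≡∑seq r (P ∘ (j ∷_)))

↔-injective : ∀ {A B : Set} (A↔B : A ↔ B) → Injective _≡_ _≡_ (Inverse.to A↔B)
↔-injective A↔B = Injection.injective (Inverse⇒Injection A↔B)

Vec-suc↔× : ∀ {A : Set} {a} → Vec A (suc a) ↔ (A × Vec A a)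
Vec-suc↔× = mk↔ₛ′ uncons (uncurry _∷_) (λ _ → refl) λ { (x ∷ xs) → refl }

Vec↔Fin^ : ∀ {A : Set} {m} → A ↔ Fin m → ∀ a → Vec A a ↔ Fin (m ^ a)
Vec↔Fin^ A↔Fin zero    = mk↔ₛ′ (λ _ → zero) (λ _ → []) (λ { zero → refl }) λ { [] → refl }
Vec↔Fin^ A↔Fin (suc a) = ↔-trans Vec-suc↔× (↔-trans (A↔Fin ×-↔ Vec↔Fin^ A↔Fin a) (↔-sym *↔×))

Vec-injection⇒≤ : ∀ {A : Set} {m a t} → A ↔ Fin m → 1 < m →
                  (f : Vec A a → Vec A t) → Injective _≡_ _≡_ f → a ≤ t
Vec-injection⇒≤ {m = m} {a} {t} A↔Fin 1<m f f-inj =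
  ≮⇒≥ λ t<a → <⇒≱ (^-monoʳ-< m 1<m t<a) m^a≤m^t
  where
  Vₐ = Vec↔Fin^ A↔Fin a
  Vₜ = Vec↔Fin^ A↔Fin t
  m^a≤m^t : m ^ a ≤ m ^ t
  m^a≤m^t = injective⇒≤ {f = Inverse.to Vₜ ∘ f ∘ Inverse.from Vₐ}
                        (↔-injective (↔-sym Vₐ) ∘ f-inj ∘ ↔-injective Vₜ)

Word↔Fin : ∀ ℓ → Word ℓ ↔ Fin (4 ^ ℓ)
Word↔Fin = Vec↔Fin^ ↔-refl

#true : ∀ {k} → (Fin k → Bool) → ℕ
#true {k} P = ∑[ i < k ] 𝟙 (P i)

#true≤size : ∀ {k} (P : Fin k → Bool) → #true P ≤ k
#true≤size {k} P = ≤-trans (sum-≤-const (𝟙≤1 ∘ P)) (≤-reflexive (*-identityʳ k))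

#true-all : ∀ {k} (P : Fin k → Bool) → (∀ i → T (P i)) → #true P ≡ k
#true-all {k} P all = trans (sum-cong-≗ (T⇒𝟙≡1 ∘ all)) (trans (sum-const k 1) (*-identityʳ k))

T⇒1≤#true : ∀ {k} (P : Fin k → Bool) i → T (P i) → 1 ≤ #true P
T⇒1≤#true {suc k} P i Pi rewrite sum-remove {i = i} (𝟙 ∘ P) | T⇒𝟙≡1 Pi = s≤s z≤n

module _ {A : Set} where

  cons-if : ∀ {m} b → A → Vec A m → Vec A (𝟙 b + m)
  cons-if true  x xs = x ∷ xs
  cons-if false x xs = xs

  uncons-if : ∀ {m} b → A → Vec A (𝟙 b + m) → A × Vec A m
  uncons-if true  d (x ∷ xs) = x , xs
  uncons-if false d xs       = d , xs

  cons-if-uncons-if : ∀ {m} b d (xs : Vec A (𝟙 b + m)) →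
                      uncurry (cons-if b) (uncons-if b d xs) ≡ xs
  cons-if-uncons-if true  d (x ∷ xs) = refl
  cons-if-uncons-if false d xs       = refl

  cons-if-cong : ∀ {m} b {x y : A} {xs ys : Vec A m} →
                 (T b → x ≡ y) → xs ≡ ys → cons-if b x xs ≡ cons-if b y ys
  cons-if-cong true  x≡y refl = cong (_∷ _) (x≡y _)
  cons-if-cong false x≡y xs≡ys = xs≡ys

  select : ∀ {k} (P : Fin k → Bool) → Vec A k → Vec A (#true P)
  select P []      = []
  select P (u ∷ U) = cons-if (P zero) u (select (P ∘ suc) U)

  expand : ∀ {k} → A → (P : Fin k → Bool) → Vec A (#true P) → Vec A k
  expand {zero}  d P w = []
  expand {suc k} d P w = let u , w′ = uncons-if (P zero) d w in u ∷ expand d (P ∘ suc) w′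

  select-expand : ∀ {k} d (P : Fin k → Bool) (w : Vec A (#true P)) → select P (expand d P w) ≡ w
  select-expand {zero}  d P [] = refl
  select-expand {suc k} d P w =
    trans (cong (cons-if (P zero) (proj₁ u,w′)) (select-expand d (P ∘ suc) (proj₂ u,w′)))
          (cons-if-uncons-if (P zero) d w)
    where u,w′ = uncons-if (P zero) d w

  select-cong : ∀ {k} (P : Fin k → Bool) (U V : Vec A k) →
                (∀ i → T (P i) → lookup U i ≡ lookup V i) → select P U ≡ select P V
  select-cong P []      []      agree = refl
  select-cong P (u ∷ U) (v ∷ V) agree =
    cons-if-cong (P zero) (agree zero) (select-cong (P ∘ suc) U V (agree ∘ suc))

map-≡⇒agree-on : ∀ {A B : Set} {g h : A → B} {r} (s : Vec A r) →
                 map g s ≡ map h s → ∀ {j} → j ∈ s → g j ≡ h j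
map-≡⇒agree-on (x ∷ s) eq (here refl) = proj₁ (∷-injective eq)
map-≡⇒agree-on (x ∷ s) eq (there j∈s) = map-≡⇒agree-on s (proj₂ (∷-injective eq)) j∈s

≗⇒≡ : ∀ {A : Set} {m} {xs ys : Vec A m} → (∀ i → lookup xs i ≡ lookup ys i) → xs ≡ ys
≗⇒≡ {xs = xs} {ys} eq = trans (sym (tabulate∘lookup xs)) (trans (tabulate-cong eq) (tabulate∘lookup ys))

∈-init⁻ : ∀ {A : Set} {r} {j : A} (s : Vec A (suc r)) → j ∈ init s → j ∈ s
∈-init⁻ (x ∷ y ∷ s) (here j≡x)  = here j≡x
∈-init⁻ (x ∷ y ∷ s) (there j∈s) = there (∈-init⁻ (y ∷ s) j∈s)

∑⊓ : ℕ → ℕ → ℕ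
∑⊓ k zero    = 0
∑⊓ k (suc R) = ∑⊓ k R + R ⊓ k

2*∑⊓-below : ∀ k j → j ≤ k → 2 * ∑⊓ k j + j ≡ j * j
2*∑⊓-below k zero    _    = refl
2*∑⊓-below k (suc j) j<k rewrite m≤n⇒m⊓n≡m (<⇒≤ j<k) = begin
  2 * (∑⊓ k j + j) + suc j     ≡⟨ regroup (∑⊓ k j) j ⟩
  2 * ∑⊓ k j + j + (2 * j + 1) ≡⟨ cong (_+ (2 * j + 1)) (2*∑⊓-below k j (<⇒≤ j<k)) ⟩
  j * j + (2 * j + 1)          ≡⟨ square-suc j ⟩
  suc j * suc j                ∎
  where
  open ≡-Reasoning
  regroup : ∀ m j → 2 * (m + j) + suc j ≡ 2 * m + j + (2 * j + 1)
  regroup = solve-∀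
  square-suc : ∀ j → j * j + (2 * j + 1) ≡ suc j * suc j
  square-suc = solve-∀

∑⊓-above : ∀ k d → ∑⊓ k (k + d) ≡ ∑⊓ k k + d * k
∑⊓-above k zero    rewrite +-identityʳ k = sym (+-identityʳ _)
∑⊓-above k (suc d) rewrite +-suc k d | ∑⊓-above k d | m≥n⇒m⊓n≡n (m≤m+n k d) =
  trans (+-assoc (∑⊓ k k) (d * k) k) (cong (_+_ (∑⊓ k k)) (+-comm (d * k) k))

2*∑⊓ : ∀ {k R} → k ≤ R → 2 * ∑⊓ k R + k * (k + 1) ≡ 2 * R * k
2*∑⊓ {k} k≤R with d , refl ← m≤n⇒∃[o]m+o≡n k≤R = begin
  2 * ∑⊓ k (k + d) + k * (k + 1)        ≡⟨ cong (λ x → 2 * x + k * (k + 1)) (∑⊓-above k d) ⟩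
  2 * (∑⊓ k k + d * k) + k * (k + 1)    ≡⟨ regroup (∑⊓ k k) d k ⟩
  (2 * ∑⊓ k k + k) + k * k + 2 * d * k  ≡⟨ cong (λ x → x + k * k + 2 * d * k) (2*∑⊓-below k k ≤-refl) ⟩
  k * k + k * k + 2 * d * k             ≡⟨ collect d k ⟩
  2 * (k + d) * k                       ∎
  where
  open ≡-Reasoning
  regroup : ∀ m d k → 2 * (m + d * k) + k * (k + 1) ≡ (2 * m + k) + k * k + 2 * d * k
  regroup = solve-∀
  collect : ∀ d k → k * k + k * k + 2 * d * k ≡ 2 * (k + d) * k
  collect = solve-∀

bernoulli : ∀ m t → m ^ t * (m + t) ≤ m * suc m ^ t
bernoulli m zero    = ≤-reflexive (trans (+-identityʳ (m + 0)) (trans (+-identityʳ m) (sym (*-identityʳ m))))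
bernoulli m (suc t) = begin
  m ^ suc t * (m + suc t)                 ≡⟨ split m (m ^ t) t ⟩
  m * (m ^ t * (m + t)) + m ^ t * m       ≤⟨ +-monoʳ-≤ _ (*-monoʳ-≤ (m ^ t) (m≤m+n m t)) ⟩
  m * (m ^ t * (m + t)) + m ^ t * (m + t) ≡⟨ +-comm (m * _) _ ⟩
  suc m * (m ^ t * (m + t))               ≤⟨ *-monoʳ-≤ (suc m) (bernoulli m t) ⟩
  suc m * (m * suc m ^ t)                 ≡⟨ exchange (suc m) m (suc m ^ t) ⟩
  m * suc m ^ suc t                       ∎
  where
  open ≤-Reasoning
  split : ∀ m p t → m * p * (m + suc t) ≡ m * (p * (m + t)) + p * m
  split = solve-∀
  exchange : ∀ a b c → a * (b * c) ≡ b * (a * c)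
  exchange = solve-∀

polynomial≤exponential : ∀ n .{{_ : NonZero n}} q k → ∃[ R ] k ≤ R × q * R * (n * (n ∸ 1) ^ R) ≤ n ^ R
polynomial≤exponential (suc zero) q k = suc k , n≤1+n k , ≤-trans (≤-reflexive (*-zeroʳ (q * suc k))) z≤n
polynomial≤exponential (suc (suc m′)) q k = H + H , ≤-trans (m≤m+n k X) (m≤m+n H H) , bound
  where
  -- Square Bernoulli's (1 + 1/m)^H ≥ 1 + H/m: then (1 + 1/m)^(2H) ≥ H²/m²,
  -- which beats q · 2H · (m+1) once H ≥ X.
  m = suc m′
  X = m * m * q * 2 * suc m
  H = k + X
  P = m ^ H
  Q = suc m ^ H
  bound′ : m * m * (q * (H + H) * (suc m * (P * P))) ≤ m * m * (Q * Q)
  bound′ = begin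
    m * m * (q * (H + H) * (suc m * (P * P))) ≡⟨ regroup m q H P ⟩
    X * H * (P * P)                          ≤⟨ *-monoˡ-≤ (P * P) (*-monoˡ-≤ H (m≤n+m X k)) ⟩
    H * H * (P * P)                          ≤⟨ *-monoˡ-≤ (P * P) (*-mono-≤ (m≤n+m H m) (m≤n+m H m)) ⟩
    (m + H) * (m + H) * (P * P)              ≡⟨ square-product P (m + H) ⟩
    P * (m + H) * (P * (m + H))              ≤⟨ *-mono-≤ (bernoulli m H) (bernoulli m H) ⟩
    m * Q * (m * Q)                          ≡⟨ square-product′ m Q ⟩
    m * m * (Q * Q)                          ∎
    where
    open ≤-Reasoning
    regroup : ∀ m q H P →
              m * m * (q * (H + H) * (suc m * (P * P))) ≡ m * m * q * 2 * suc m * H * (P * P)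
    regroup = solve-∀
    square-product : ∀ P y → y * y * (P * P) ≡ P * y * (P * y)
    square-product = solve-∀
    square-product′ : ∀ m Q → m * Q * (m * Q) ≡ m * m * (Q * Q)
    square-product′ = solve-∀
  bound : q * (H + H) * (suc m * m ^ (H + H)) ≤ suc m ^ (H + H)
  bound rewrite ^-distribˡ-+-* m H H | ^-distribˡ-+-* (suc m) H H = *-cancelˡ-≤ (m * m) bound′

infixl 7 _//_
_//_ : ℕ → (d : ℕ) → .{{NonZero d}} → ℚᵘ
a // d = (+ a) ℚᵘ./ d

toℚᵘ-/ : ∀ a d .{{_ : NonZero d}} → ℚ.toℚᵘ ((+ a) ℚ./ d) ≃ a // d
toℚᵘ-/ a (suc d) = toℚᵘ-fromℚᵘ (a // suc d)

//-cong : ∀ {a b} d e .{{_ : NonZero d}} .{{_ : NonZero e}} → a * e ≡ b * d → a // d ≃ b // e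
//-cong {a} {b} (suc d) (suc e) eq =
  *≡* (trans (sym (pos-* a (suc e))) (trans (cong +_ eq) (pos-* b (suc d))))

//-mono-≤ : ∀ {a b} d e .{{_ : NonZero d}} .{{_ : NonZero e}} → a * e ≤ b * d → a // d ℚᵘ.≤ b // e
//-mono-≤ {a} {b} (suc d) (suc e) le =
  *≤* (subst₂ ℤ._≤_ (pos-* a (suc e)) (pos-* b (suc d)) (+≤+ le))

+-// : ∀ a b d e .{{_ : NonZero d}} .{{_ : NonZero e}} →
       a // d ℚᵘ.+ b // e ≡ ((a * e + b * d) // (d * e)) {{m*n≢0 d e}}
+-// a b (suc d) (suc e) =
  cong (ℚᵘ._/ (suc d * suc e)) (cong₂ ℤ._+_ (sym (pos-* a (suc e))) (sym (pos-* b (suc d))))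

//-+-scale : ∀ a b n d .{{_ : NonZero d}} .{{_ : NonZero (n * d)}} →
            a // d ℚᵘ.+ b // (n * d) ≃ (n * a + b) // (n * d)
//-+-scale a b n@(suc _) d@(suc _) =
  ℚᵘₚ.≃-trans (ℚᵘₚ.≃-reflexive (+-// a b d (n * d)))
              (//-cong (d * (n * d)) (n * d) (cross a b n d))
  where
  cross : ∀ a b n d → (a * (n * d) + b * d) * (n * d) ≡ (n * a + b) * (d * (n * d))
  cross = solve-∀

p≤q+r⇒p-r≤q : ∀ {x y z : ℚᵘ} → x ℚᵘ.≤ y ℚᵘ.+ z → x ℚᵘ.- z ℚᵘ.≤ y
p≤q+r⇒p-r≤q {x} {y} {z} x≤y+z = ℚᵘₚ.≤-respʳ-≃ cancel (ℚᵘₚ.+-monoˡ-≤ (ℚᵘ.- z) x≤y+z)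
  where
  cancel : (y ℚᵘ.+ z) ℚᵘ.- z ≃ y
  cancel = ℚᵘₚ.≃-trans (ℚᵘₚ.+-assoc y z (ℚᵘ.- z))
             (ℚᵘₚ.≃-trans (ℚᵘₚ.+-congʳ y (ℚᵘₚ.+-inverseʳ z)) (ℚᵘₚ.+-identityʳ y))

//-//≤// : ∀ {a b c} d e f .{{_ : NonZero d}} .{{_ : NonZero e}} .{{_ : NonZero f}} →
           a * (f * e) ≤ (c * e + b * f) * d → a // d ℚᵘ.- b // e ℚᵘ.≤ c // f
//-//≤// {a} {b} {c} d e@(suc _) f@(suc _) le =
  p≤q+r⇒p-r≤q (subst (a // d ℚᵘ.≤_) (sym (+-// c b f e)) (//-mono-≤ d (f * e) le))

-- Recovering strands from draws

missed-by : ∀ {n r} → Vec (Fin n) r → Fin n → Bool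
missed-by s j = ⌊ ¬? (j ∈? s) ⌋

∑seq-missed-by≤ : ∀ {n} R (j : Fin n) → ∑seq R (λ s → 𝟙 (missed-by s j)) ≤ (n ∸ 1) ^ R
∑seq-missed-by≤ zero j = ≤-refl
∑seq-missed-by≤ {suc m} (suc R) j =
  sum-≤-punctured _ j hit λ j′ →
    ≤-trans (∑seq-mono-≤ R (𝟙-mono ∘ still-missed j′)) (∑seq-missed-by≤ R j)
  where
  hit : ∑seq R (λ v → 𝟙 (missed-by (j ∷ v) j)) ≡ 0
  hit = trans (∑seq-cong R λ v → ¬T⇒𝟙≡0 λ missed → toWitness missed (here refl))
              (trans (∑seq-const R 0) (*-zeroʳ (suc m ^ R)))
  still-missed : ∀ j′ v → T (missed-by (j′ ∷ v) j) → T (missed-by v j)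
  still-missed j′ v missed = fromWitness λ j∈v → toWitness missed (there j∈v)

∑seq-#missed≤ : ∀ {n} R → ∑seq {n} R (#true ∘ missed-by) ≤ n * (n ∸ 1) ^ R
∑seq-#missed≤ {n} R =
  ≤-trans (≤-reflexive (∑seq-comm R (λ j s → 𝟙 (missed-by s j))))
          (sum-≤-const {n} (∑seq-missed-by≤ R))

module _ {ℓ n k} (C : Code ℓ n k) where

  recovered-by : ∀ {r} → Vec (Fin n) r → Fin k → Bool
  recovered-by s i = ⌊ recoverable? C i s ⌋

  Recoverable-init : ∀ {r} {i} (s : Vec (Fin n) (suc r)) → Recoverable C i (init s) → Recoverable C i s
  Recoverable-init s rec U V agree = rec U V λ j j∈init → agree j (∈-init⁻ s j∈init)

  covering⇒Recoverable : Injective _≡_ _≡_ C → ∀ {r} {i} (s : Vec (Fin n) r) →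
                         (∀ j → j ∈ s) → Recoverable C i s
  covering⇒Recoverable C-inj s covers U V agree =
    cong (λ W → lookup W _) (C-inj (≗⇒≡ λ j → agree j (covers j)))

  #recovered≤length : 1 ≤ ℓ → ∀ {r} (s : Vec (Fin n) r) → #true (recovered-by s) ≤ r
  #recovered≤length 1≤ℓ {r} s = Vec-injection⇒≤ (Word↔Fin ℓ) 1<4^ℓ observe observe-injective
    where
    -- Place the recovered strands into a message (any fixed word elsewhere) and observe it through s.
    P = recovered-by s
    extend : Vec (Word ℓ) (#true P) → Message ℓ k
    extend = expand (replicate ℓ zero) P
    observe : Vec (Word ℓ) (#true P) → Vec (Word ℓ) r
    observe w = map (lookup (C (extend w))) s
    observe-injective : Injective _≡_ _≡_ observe
    observe-injective {w} {w′} eq = begin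
      w                        ≡⟨ select-expand _ P w ⟨
      select P (extend w)      ≡⟨ select-cong P (extend w) (extend w′) recovered ⟩
      select P (extend w′)     ≡⟨ select-expand _ P w′ ⟩
      w′                       ∎
      where
      open ≡-Reasoning
      recovered : ∀ i → T (P i) → lookup (extend w) i ≡ lookup (extend w′) i
      recovered i Pi = toWitness Pi (extend w) (extend w′) λ j → map-≡⇒agree-on s eq
    1<4^ℓ : 1 < 4 ^ ℓ
    1<4^ℓ = ^-monoʳ-< 4 (s≤s (s≤s z≤n)) 1≤ℓ

  k≤#recovered+k*#missed : Injective _≡_ _≡_ C → ∀ {r} (s : Vec (Fin n) r) →
                           k ≤ #true (recovered-by s) + k * #true (missed-by s)
  k≤#recovered+k*#missed C-inj s with all? (_∈? s)
  ... | yes covers = ≤-trans (≤-reflexive (sym all-recovered)) (m≤m+n _ _)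
    where
    all-recovered = #true-all (recovered-by s) λ i → fromWitness (covering⇒Recoverable C-inj s covers)
  ... | no ¬covers with j , j∉s ← ¬∀⟶∃¬ n _ (_∈? s) ¬covers =
    ≤-trans (≤-trans (≤-reflexive (sym (*-identityʳ k)))
                     (*-monoʳ-≤ k (T⇒1≤#true (missed-by s) j (fromWitness j∉s))))
            (m≤n+m _ _)

  #recovering : Fin k → ℕ → ℕ
  #recovering i r = ∑seq r (λ s → 𝟙 (recovered-by s i))

  #stopping : Fin k → ℕ → ℕ
  #stopping i r = count (suc r) (stopsAt C i)

  #stopping+n*#recovering : ∀ i r → #stopping i r + n * #recovering i r ≡ #recovering i (suc r)
  #stopping+n*#recovering i r = begin
    #stopping i r + n * #recovering i r
      ≡⟨ cong₂ _+_ (count≡∑seq (suc r) (stopsAt C i)) (sym (∑seq-init r (λ s → 𝟙 (recovered-by s i)))) ⟩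
    ∑seq (suc r) (𝟙 ∘ stopsAt C i) + ∑seq (suc r) (λ s → 𝟙 (recovered-by (init s) i))
      ≡⟨ ∑seq-distrib-+ (suc r) (𝟙 ∘ stopsAt C i) (λ s → 𝟙 (recovered-by (init s) i)) ⟨
    ∑seq (suc r) (λ s → 𝟙 (stopsAt C i s) + 𝟙 (recovered-by (init s) i))
      ≡⟨ ∑seq-cong (suc r) (λ s → 𝟙-∧-not (recovered-by s i) (recovered-by (init s) i)
                                          (fromWitness ∘ Recoverable-init s ∘ toWitness)) ⟩
    #recovering i (suc r)
      ∎
    where open ≡-Reasoning

  ∑#recovering≤ : 1 ≤ ℓ → ∀ r → ∑[ i < k ] #recovering i r ≤ n ^ r * (r ⊓ k)
  ∑#recovering≤ 1≤ℓ r = begin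
    ∑[ i < k ] #recovering i r       ≡⟨ ∑seq-comm r (λ i s → 𝟙 (recovered-by s i)) ⟨
    ∑seq r (#true ∘ recovered-by)    ≤⟨ ∑seq-mono-≤ r (λ s → ⊓-glb (#recovered≤length 1≤ℓ s) (#true≤size _)) ⟩
    ∑seq r (λ _ → r ⊓ k)             ≡⟨ ∑seq-const r (r ⊓ k) ⟩
    n ^ r * (r ⊓ k)                  ∎
    where open ≤-Reasoning

  ∑#recovering≥ : Injective _≡_ _≡_ C → ∀ r →
                  n ^ r * k ≤ ∑[ i < k ] #recovering i r + k * (n * (n ∸ 1) ^ r)
  ∑#recovering≥ C-inj r = begin
    n ^ r * k
      ≡⟨ ∑seq-const r k ⟨
    ∑seq r (λ _ → k)
      ≤⟨ ∑seq-mono-≤ r (k≤#recovered+k*#missed C-inj) ⟩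
    ∑seq r (λ s → #true (recovered-by s) + k * #true (missed-by s))
      ≡⟨ ∑seq-distrib-+ r _ _ ⟩
    ∑seq r (#true ∘ recovered-by) + ∑seq r (λ s → k * #true (missed-by s))
      ≡⟨ cong₂ _+_ (∑seq-comm r (λ i s → 𝟙 (recovered-by s i))) (sym (*-distribˡ-∑seq r k _)) ⟩
    ∑[ i < k ] #recovering i r + k * ∑seq r (#true ∘ missed-by)
      ≤⟨ +-monoʳ-≤ _ (*-monoʳ-≤ k (∑seq-#missed≤ r)) ⟩
    ∑[ i < k ] #recovering i r + k * (n * (n ∸ 1) ^ r)
      ∎
    where open ≤-Reasoning

  -- scaledE i R = n^R · partialE C i R and deficit i R = ∑_{r<R} n^(R−r) · #recovering i r,
  -- so that scaledE+deficit is summation by parts.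
  scaledE : Fin k → ℕ → ℕ
  scaledE i zero    = 0
  scaledE i (suc R) = n * scaledE i R + suc R * #stopping i R

  deficit : Fin k → ℕ → ℕ
  deficit i zero    = 0
  deficit i (suc R) = n * (deficit i R + #recovering i R)

  scaledE+deficit : ∀ i R → scaledE i R + deficit i R ≡ R * #recovering i R
  scaledE+deficit i zero    = refl
  scaledE+deficit i (suc R) = begin
    n * Z + suc R * c + n * (W + N)     ≡⟨ regroup n Z W c R N ⟩
    n * (Z + W) + suc R * c + n * N     ≡⟨ cong (λ x → n * x + suc R * c + n * N) (scaledE+deficit i R) ⟩
    n * (R * N) + suc R * c + n * N     ≡⟨ collect n R c N ⟩
    suc R * (c + n * N)                 ≡⟨ cong (suc R *_) (#stopping+n*#recovering i R) ⟩
    suc R * #recovering i (suc R)       ∎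
    where
    open ≡-Reasoning
    Z = scaledE i R
    W = deficit i R
    N = #recovering i R
    c = #stopping i R
    regroup : ∀ n Z W c R N → n * Z + suc R * c + n * (W + N) ≡ n * (Z + W) + suc R * c + n * N
    regroup = solve-∀
    collect : ∀ n R c N → n * (R * N) + suc R * c + n * N ≡ suc R * (c + n * N)
    collect = solve-∀

  ∑deficit≤ : 1 ≤ ℓ → ∀ R → ∑[ i < k ] deficit i R ≤ n ^ R * ∑⊓ k R
  ∑deficit≤ 1≤ℓ zero    = ≤-reflexive (trans (sum-const k 0) (*-zeroʳ k))
  ∑deficit≤ 1≤ℓ (suc R) = begin
    ∑[ i < k ] (n * (deficit i R + #recovering i R))
      ≡⟨ *-distribˡ-sum n (λ i → deficit i R + #recovering i R) ⟨
    n * ∑[ i < k ] (deficit i R + #recovering i R)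
      ≡⟨ cong (n *_) (∑-distrib-+ (λ i → deficit i R) (λ i → #recovering i R)) ⟩
    n * (∑[ i < k ] deficit i R + ∑[ i < k ] #recovering i R)
      ≤⟨ *-monoʳ-≤ n (+-mono-≤ (∑deficit≤ 1≤ℓ R) (∑#recovering≤ 1≤ℓ R)) ⟩
    n * (n ^ R * ∑⊓ k R + n ^ R * (R ⊓ k))
      ≡⟨ cong (n *_) (*-distribˡ-+ (n ^ R) (∑⊓ k R) (R ⊓ k)) ⟨
    n * (n ^ R * (∑⊓ k R + R ⊓ k))
      ≡⟨ *-assoc n (n ^ R) _ ⟨
    n ^ suc R * ∑⊓ k (suc R)
      ∎
    where open ≤-Reasoning

  R*∑#recovering : ∀ R →
                   R * ∑[ i < k ] #recovering i R ≡ ∑[ i < k ] scaledE i R + ∑[ i < k ] deficit i R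
  R*∑#recovering R = begin
    R * ∑[ i < k ] #recovering i R                  ≡⟨ *-distribˡ-sum R (λ i → #recovering i R) ⟩
    ∑[ i < k ] (R * #recovering i R)                ≡⟨ sum-cong-≗ (λ i → scaledE+deficit i R) ⟨
    ∑[ i < k ] (scaledE i R + deficit i R)          ≡⟨ ∑-distrib-+ (λ i → scaledE i R) (λ i → deficit i R) ⟩
    ∑[ i < k ] scaledE i R + ∑[ i < k ] deficit i R ∎
    where open ≡-Reasoning

  ∑scaledE≥ : Injective _≡_ _≡_ C → 1 ≤ ℓ → ∀ {R} → k ≤ R →
              k * (k + 1) * n ^ R ≤ 2 * ∑[ i < k ] scaledE i R + 2 * R * k * (n * (n ∸ 1) ^ R)
  ∑scaledE≥ C-inj 1≤ℓ {R} k≤R = +-cancelˡ-≤ (2 * ∑W) _ _ (begin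
    2 * ∑W + k * (k + 1) * n ^ R               ≤⟨ +-monoˡ-≤ _ (*-monoʳ-≤ 2 (∑deficit≤ 1≤ℓ R)) ⟩
    2 * (n ^ R * ∑⊓ k R) + k * (k + 1) * n ^ R ≡⟨ factor (n ^ R) (∑⊓ k R) k ⟩
    n ^ R * (2 * ∑⊓ k R + k * (k + 1))         ≡⟨ cong (n ^ R *_) (2*∑⊓ k≤R) ⟩
    n ^ R * (2 * R * k)                        ≡⟨ swap (n ^ R) R k ⟩
    2 * R * (n ^ R * k)                        ≤⟨ *-monoʳ-≤ (2 * R) (∑#recovering≥ C-inj R) ⟩
    2 * R * (∑N + k * B)                       ≡⟨ distribute R ∑N k B ⟩
    2 * (R * ∑N) + 2 * R * k * B               ≡⟨ cong (λ x → 2 * x + 2 * R * k * B) (R*∑#recovering R) ⟩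
    2 * (∑Z + ∑W) + 2 * R * k * B              ≡⟨ regroup ∑Z ∑W (2 * R * k * B) ⟩
    2 * ∑W + (2 * ∑Z + 2 * R * k * B)          ∎)
    where
    open ≤-Reasoning
    ∑N = ∑[ i < k ] #recovering i R
    ∑Z = ∑[ i < k ] scaledE i R
    ∑W = ∑[ i < k ] deficit i R
    B  = n * (n ∸ 1) ^ R
    factor : ∀ p m k → 2 * (p * m) + k * (k + 1) * p ≡ p * (2 * m + k * (k + 1))
    factor = solve-∀
    swap : ∀ p R k → p * (2 * R * k) ≡ 2 * R * (p * k)
    swap = solve-∀
    distribute : ∀ R S k B → 2 * R * (S + k * B) ≡ 2 * (R * S) + 2 * R * k * B
    distribute = solve-∀
    regroup : ∀ z w x → 2 * (z + w) + x ≡ 2 * w + (2 * z + x)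
    regroup = solve-∀

-- The expected stopping time

∃scaledE≥ : ∀ {ℓ n k} (C : Code ℓ n k) → Injective _≡_ _≡_ C → 1 ≤ ℓ → 1 ≤ k →
            ∀ {R} → k ≤ R →
            ∃[ i ] (k + 1) * n ^ R ≤ 2 * scaledE C i R + 2 * R * (n * (n ∸ 1) ^ R)
∃scaledE≥ {n = n} {suc k} C C-inj 1≤ℓ _ {R} k≤R with i , ∑≤ ← ∃-sum≤*max (λ i → scaledE C i R) =
  i , *-cancelˡ-≤ (suc k) (begin
    suc k * ((suc k + 1) * n ^ R)          ≡⟨ *-assoc (suc k) (suc k + 1) (n ^ R) ⟨
    suc k * (suc k + 1) * n ^ R            ≤⟨ ∑scaledE≥ C C-inj 1≤ℓ k≤R ⟩
    2 * ∑Z + 2 * R * suc k * B             ≤⟨ +-monoˡ-≤ _ (*-monoʳ-≤ 2 ∑≤) ⟩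
    2 * (suc k * Zᵢ) + 2 * R * suc k * B   ≡⟨ factor (suc k) Zᵢ R B ⟩
    suc k * (2 * Zᵢ + 2 * R * B)           ∎)
  where
  open ≤-Reasoning
  Zᵢ = scaledE C i R
  ∑Z = ∑[ j < suc k ] scaledE C j R
  B  = n * (n ∸ 1) ^ R
  factor : ∀ k z R b → 2 * (k * z) + 2 * R * k * b ≡ k * (2 * z + 2 * R * b)
  factor = solve-∀

partialE≃scaledE : ∀ {ℓ n k} .{{_ : NonZero n}} (C : Code ℓ n k) i R →
                   ℚ.toℚᵘ (partialE C i R) ≃ (scaledE C i R // n ^ R) {{m^n≢0 n R}}
partialE≃scaledE C i zero    = ℚᵘₚ.≃-refl
partialE≃scaledE {n = n} C i (suc R) =
  ℚᵘₚ.≃-trans (toℚᵘ-homo-+ (partialE C i R) (term C i R))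
    (ℚᵘₚ.≃-trans (ℚᵘₚ.+-cong (partialE≃scaledE C i R) (toℚᵘ-/ _ (n ^ suc R)))
      (//-+-scale (scaledE C i R) (suc R * #stopping C i R) n (n ^ R)))
  where instance
  _ = m^n≢0 n R
  _ = m^n≢0 n (suc R)

-- (a/2) − (p+1)/q ≤ Z/D, cross-multiplied, from aD ≤ 2Z + 2RB and the error term qRB ≤ D.
cross-multiplied-bound : ∀ {a D Z R B q} p → a * D ≤ 2 * Z + 2 * R * B → q * R * B ≤ D →
                         a * (D * q) ≤ (Z * q + suc p * D) * 2
cross-multiplied-bound {a} {D} {Z} {R} {B} {q} p aD≤ qRB≤D = begin
  a * (D * q)                   ≡⟨ *-assoc a D q ⟨
  a * D * q                     ≤⟨ *-monoˡ-≤ q aD≤ ⟩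
  (2 * Z + 2 * R * B) * q       ≡⟨ distribute Z R B q ⟩
  2 * (Z * q) + 2 * (q * R * B) ≤⟨ +-monoʳ-≤ (2 * (Z * q)) (*-monoʳ-≤ 2 qRB≤sucp*D) ⟩
  2 * (Z * q) + 2 * (suc p * D) ≡⟨ factor (Z * q) (suc p * D) ⟩
  (Z * q + suc p * D) * 2       ∎
  where
  open ≤-Reasoning
  qRB≤sucp*D : q * R * B ≤ suc p * D
  qRB≤sucp*D = ≤-trans qRB≤D (m≤m+n D (p * D))
  distribute : ∀ Z R B q → (2 * Z + 2 * R * B) * q ≡ 2 * (Z * q) + 2 * (q * R * B)
  distribute = solve-∀
  factor : ∀ x y → 2 * x + 2 * y ≡ (x + y) * 2
  factor = solve-∀

partialE-lower : ∀ {ℓ n k} .{{_ : NonZero n}} (C : Code ℓ n k) i R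
                   {p q} .{c : Coprime (suc p) (suc q)} →
                 (k + 1) * n ^ R ≤ 2 * scaledE C i R + 2 * R * (n * (n ∸ 1) ^ R) →
                 suc q * R * (n * (n ∸ 1) ^ R) ≤ n ^ R →
                 (+ (k + 1)) / 2 ℚ.- mkℚ +[1+ p ] q c ℚ.≤ partialE C i R
partialE-lower {n = n} {k} C i R {p} {q} {c} large rare-miss = toℚᵘ-cancel-≤ (begin
  ℚ.toℚᵘ ((+ (k + 1)) / 2 ℚ.- ε)   ≃⟨ ℚᵘₚ.≃-trans (toℚᵘ-homo-+ ((+ (k + 1)) / 2) (ℚ.- ε))
                                                    (ℚᵘₚ.+-cong (toℚᵘ-/ (k + 1) 2) (toℚᵘ-homo‿- ε)) ⟩
  (k + 1) // 2 ℚᵘ.- suc p // suc q ≤⟨ //-//≤// {k + 1} {suc p} {scaledE C i R} 2 (suc q) (n ^ R) bound ⟩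
  scaledE C i R // n ^ R           ≃⟨ partialE≃scaledE C i R ⟨
  ℚ.toℚᵘ (partialE C i R)          ∎)
  where
  open ℚᵘₚ.≤-Reasoning
  ε = mkℚ +[1+ p ] q c
  instance _ = m^n≢0 n R
  bound : (k + 1) * (n ^ R * suc q) ≤ (scaledE C i R * suc q + suc p * n ^ R) * 2
  bound = cross-multiplied-bound {k + 1} {n ^ R} {scaledE C i R} {R} {n * (n ∸ 1) ^ R} {suc q}
                                 p large rare-miss

lemma2 : ∀ (ℓ n k : ℕ) → 1 ≤ ℓ → 1 ≤ k → .{{_ : NonZero n}} →
           (C : Code ℓ n k) → Injective _≡_ _≡_ C →
           TmaxAtLeast C ((+ (k + 1)) / 2)
lemma2 ℓ n k 1≤ℓ 1≤k C C-inj (mkℚ +[1+ p ] q _) _ =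
  let R , k≤R , rare-miss = polynomial≤exponential n (suc q) k
      i , large = ∃scaledE≥ C C-inj 1≤ℓ 1≤k k≤R
  in i , R , partialE-lower C i R large rare-miss
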